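{- Let $P$ be a nondisjunctive CR-Prolog program with some abductive support $R$. For all cr-rules $r_1, r_2\in R$: if $\mathrm{head}(r_1)=\mathrm{head}(r_2)$, then $r_1=r_2$.
   Context: A literal is an atom $a$ or its classical negation $\neg a$; a context is a consistent set of literals (all contexts considered are consistent). A regular rule $r$ has the form $l_1 \vee \dots \vee l_k \leftarrow l_{k+1},\dots,l_m, \mathrm{not}\ l_{m+1},\dots,\mathrm{not}\ l_n$ with $1\le k\le m\le n$; $\mathrm{head}(r)=\{l_1,\dots,l_k\}$; $r$ is nondisjunctive if $k=1$. A context $X$ satisfies $r$ if, whenever $l_{k+1},\dots,l_m\in X$ and $l_{m+1},\dots,l_n\notin X$, some head literal is in $X$. An A-Prolog program is a finite set of regular rules. For a program without default negation ($m=n$ in all rules), $X$ is an answer set if $X$ satisfies it and no proper subset does; in general, the reduct $P^X$ removes every rule containing $\mathrm{not}\ l$ with $l\in X$ and deletes the remaining $\mathrm{not}$-literals, and $X$ is an answer set of $P$ if it is an answer set of $P^X$; $P$ is consistent if it has an answer set. A cr-rule has the form $l_0 \stackrel{+}{\leftarrow} l_1,\dots,l_m,\mathrm{not}\ l_{m+1},\dots,\mathrm{not}\ l_n$ with $\mathrm{head}=\{l_0\}$. A CR-Prolog program $P$ is a finite set of regular rules and cr-rules, $P^{reg}$ its regular rules, $P^{cr}$ its cr-rules; $P$ is nondisjunctive if all its regular rules are. For a cr-rule $r$, $\alpha(r)$ is the regular rule obtained by replacing $\stackrel{+}{\leftarrow}$ by $\leftarrow$, and $\alpha(R)=\{\alpha(r):r\in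 R\}$. $R\subseteq P^{cr}$ is an abductive support of $P$ if $P^{reg}\cup\alpha(R)$ is consistent and there is no $R'\subseteq P^{cr}$ with $|R'|<|R|$ such that $P^{reg}\cup\alpha(R')$ is consistent. -}

module Defs where

open import Data.Nat using (ℕ; _<_)
import Data.Nat.Properties as ℕP
open import Data.List using (List; []; _∷_; _++_; map; filter)
open import Data.List.Relation.Unary.All using (All; all?)
open import Data.List.Relation.Unary.Any using (Any)
open import Data.List.Membership.Propositional using (_∈_; _∉_)
open import Data.List.Relation.Binary.Subset.Propositional using (_⊆_)
open import Data.Vec using (Vec; []; _∷_)
open import Data.Fin.Subset using (Subset; inside; outside; ∣_∣)
open import Data.Product using (Σ; _×_; ∃)
open import Data.Empty using (⊥)
open import Relation.Nullary using (¬_; Dec; yes; no; ¬?)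

open import Relation.Binary.PropositionalEquality using (_≡_; refl; cong)
open import Relation.Binary.Definitions using (DecidableEquality)

-- Atoms are natural numbers; a literal is an atom or its classical negation.
data Literal : Set where
  lit⁺ : ℕ → Literal
  lit⁻ : ℕ → Literal

_≟ₗ_ : DecidableEquality Literal
lit⁺ a ≟ₗ lit⁺ b with a ℕP.≟ b
... | yes refl = yes refl
... | no a≢b = no λ { refl → a≢b refl }
lit⁺ a ≟ₗ lit⁻ b = no λ ()
lit⁻ a ≟ₗ lit⁺ b = no λ ()
lit⁻ a ≟ₗ lit⁻ b with a ℕP.≟ b
... | yes refl = yes refl
... | no a≢b = no λ { refl → a≢b refl }

open import Data.List.Membership.DecPropositional _≟ₗ_ using (_∈?_)

-- A (finite) context: a list of literals, read as the set of its elements.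
Context : Set
Context = List Literal

Consistent : Context → Set
Consistent X = ∀ a → lit⁺ a ∈ X → lit⁻ a ∈ X → ⊥

-- Regular rule  l₁ ∨ … ∨ lₖ ← l_{k+1},…,l_m, not l_{m+1},…,not l_n   (k ≥ 1)
record Rule : Set where
  constructor rule
  field
    head₀    : Literal
    headRest : List Literal
    body⁺    : List Literal
    body⁻    : List Literal
open Rule public

head : Rule → List Literal
head r = head₀ r ∷ headRest r

Nondisjunctive : Rule → Set
Nondisjunctive r = headRest r ≡ []

Satisfies : Context → Rule → Set
Satisfies X r =
  (∀ l → l ∈ body⁺ r → l ∈ X) → (∀ l → l ∈ body⁻ r → l ∉ X) → Any (_∈ X) (head r)

Program : Set
Program = List Rule

SatisfiesProg : Context → Program → Set
SatisfiesProg X P = All (Satisfies X) P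

-- Answer set of a program without default negation:
-- X (consistent) satisfies P and no proper subset of X does.
AnswerSetNF : Context → Program → Set
AnswerSetNF X P =
  Consistent X × SatisfiesProg X P ×
  (∀ (Y : Context) → Y ⊆ X → ¬ (X ⊆ Y) → ¬ SatisfiesProg Y P)

keep? : (X : Context) (r : Rule) → Dec (All (_∉ X) (body⁻ r))
keep? X r = all? (λ l → ¬? (l ∈? X)) (body⁻ r)

strip : Rule → Rule
strip (rule h hs bp bn) = rule h hs bp []

reduct : Program → Context → Program
reduct P X = map strip (filter (keep? X) P)

AnswerSet : Context → Program → Set
AnswerSet X P = AnswerSetNF X (reduct P X)

ConsistentProgram : Program → Set
ConsistentProgram P = ∃ λ X → AnswerSet X P

-- cr-rule  l₀ +← l₁,…,l_m, not l_{m+1},…,not l_n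
record CRRule : Set where
  constructor crrule
  field
    crHead  : Literal
    crBody⁺ : List Literal
    crBody⁻ : List Literal
open CRRule public

α : CRRule → Rule
α (crrule h bp bn) = rule h [] bp bn

-- A CR-Prolog program: regular rules P^reg and the set P^cr of cr-rules,
-- the latter enumerated without repetition by a vector (see crDistinct).
record CRProgram : Set where
  field
    reg        : Program
    ncr        : ℕ
    cr         : Vec CRRule ncr
    crDistinct : ∀ i j → Data.Vec.lookup cr i ≡ Data.Vec.lookup cr j → i ≡ j
open CRProgram public

selected : ∀ {n} → Subset n → Vec CRRule n → List CRRule
selected []            []       = []
selected (inside ∷ R)  (r ∷ rs) = r ∷ selected R rs
selected (outside ∷ R) (r ∷ rs) = selected R rs

αSet : ∀ {n} → Subset n → Vec CRRule n → Program
αSet R rs = map α (selected R rs)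

NondisjunctiveCR : CRProgram → Set
NondisjunctiveCR P = All Nondisjunctive (reg P)

AbductiveSupport : (P : CRProgram) → Subset (ncr P) → Set
AbductiveSupport P R =
  ConsistentProgram (reg P ++ αSet R (cr P)) ×
  (∀ (R' : Subset (ncr P)) → ∣ R' ∣ < ∣ R ∣ →
     ¬ ConsistentProgram (reg P ++ αSet R' (cr P)))

-- Suppose cr-rules cᵢ ≠ cⱼ of R share the head l, and let X be an answer set
-- of Q = P^reg ∪ α(R).  Removing either rule gives a smaller set of cr-rules,
-- so by minimality of R neither Qᵢ = P^reg ∪ α(R - i) nor Qⱼ = P^reg ∪ α(R - j)
-- has an answer set; in particular X is an answer set of neither.  As X
-- satisfies the reducts of these subprograms, this can only fail through
-- proper submodels Y₁ ⊂ X of Qᵢ^X and Y₂ ⊂ X of Qⱼ^X.  Neither contains l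
-- (otherwise it would already be a model of Q^X), so both dropped rules are
-- satisfied by Y₁ ∩ Y₂ vacuously, while every other rule of Q lies in Qᵢ and
-- Qⱼ and, being nondisjunctive, is preserved by the intersection.  Then
-- Y₁ ∩ Y₂ ⊂ X is a model of Q^X, contradicting minimality of X.
module Submission where

open import Defs
open import Data.Fin using (zero; suc)
import Data.Fin.Properties as Fin
open import Data.Fin.Subset using (Subset; inside; outside; _-_)
  renaming (_∈_ to _∈ₛ_; _⊆_ to _⊆ₛ_)
open import Data.Fin.Subset.Properties
  using (x∈p⇒∣p-x∣<∣p∣; x∈p∧x≢y⇒x∈p-y; p─q⊆p)
open import Data.Vec using (Vec; []; lookup; _∷_)
  renaming (here to hereₛ; there to thereₛ)
open import Data.List using (_++_; map; filter)
open import Data.List.Membership.Propositional using (_∈_; _∉_)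
open import Data.List.Membership.Propositional.Properties
  using (∈-map⁺; ∈-map⁻; ∈-++⁺ˡ; ∈-++⁺ʳ; ∈-++⁻; ∈-filter⁺; ∈-filter⁻)
open import Data.List.Membership.DecPropositional _≟ₗ_ using (_∈?_)
open import Data.List.Relation.Binary.Subset.Propositional using (_⊆_)
open import Data.List.Relation.Unary.Any using (Any; here; there)
open import Data.List.Relation.Unary.All as All using (All)
import Data.List.Relation.Unary.All.Properties as All
open import Data.Product using (∃; _×_; _,_; proj₁; proj₂)
import Data.Product as Product
open import Data.Sum using (_⊎_; inj₁; inj₂)
open import Data.Empty using (⊥; ⊥-elim)
open import Function using (_∘_)
open import Relation.Nullary using (¬_; yes; no)
open import Relation.Binary.PropositionalEquality
  using (_≡_; _≢_; refl; sym; cong; subst)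

-- Y ⊨ P ^ X : Y is a model of the reduct P^X, phrased directly on the rules
-- of P (those whose negative body avoids X, read without that body).
_⊨_^_ : Context → Program → Context → Set
Y ⊨ P ^ X = ∀ {r} → r ∈ P → All (_∉ X) (body⁻ r) →
            (∀ l → l ∈ body⁺ r → l ∈ Y) → Any (_∈ Y) (head r)

⊨-fromReduct : ∀ {Y} P X → SatisfiesProg Y (reduct P X) → Y ⊨ P ^ X
⊨-fromReduct P X sat r∈P kept body⊆Y =
  All.lookup sat (∈-map⁺ strip (∈-filter⁺ (keep? X) r∈P kept)) body⊆Y (λ _ ())

⊨-toReduct : ∀ {Y} P X → Y ⊨ P ^ X → SatisfiesProg Y (reduct P X)
⊨-toReduct {Y} P X sat = All.tabulate satisfies
  where
  satisfies : ∀ {r′} → r′ ∈ reduct P X → Satisfies Y r′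
  satisfies r′∈ with ∈-map⁻ strip r′∈
  ... | r , r∈filtered , refl with ∈-filter⁻ (keep? X) r∈filtered
  ...   | r∈P , kept = λ body⊆Y _ → sat r∈P kept body⊆Y

⊨-antitone : ∀ {P₁ P₂ X Y} → P₁ ⊆ P₂ → Y ⊨ P₂ ^ X → Y ⊨ P₁ ^ X
⊨-antitone P₁⊆P₂ sat r∈P₁ = sat (P₁⊆P₂ r∈P₁)

Minimal : Context → Program → Set
Minimal X P = ∀ Y → Y ⊆ X → ¬ (X ⊆ Y) → ¬ (Y ⊨ P ^ X)

answerSet-minimal : ∀ {X P} → AnswerSet X P → Minimal X P
answerSet-minimal {X} {P} (_ , _ , min) Y Y⊆X X⊈Y sat =
  min Y Y⊆X X⊈Y (⊨-toReduct P X sat)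

answerSet-sub : ∀ {X P P₁} → AnswerSet X P → P₁ ⊆ P → Minimal X P₁ →
                AnswerSet X P₁
answerSet-sub {X} {P} {P₁} (cons , sat , _) P₁⊆P min =
  cons
  , ⊨-toReduct P₁ X (⊨-antitone P₁⊆P (⊨-fromReduct P X sat))
  , λ Y Y⊆X X⊈Y → min Y Y⊆X X⊈Y ∘ ⊨-fromReduct P₁ X

_∩_ : Context → Context → Context
Y₁ ∩ Y₂ = filter (_∈? Y₂) Y₁

∩⁻ : ∀ {l} Y₁ Y₂ → l ∈ Y₁ ∩ Y₂ → l ∈ Y₁ × l ∈ Y₂
∩⁻ Y₁ Y₂ = ∈-filter⁻ (_∈? Y₂) {xs = Y₁}

∩⁺ : ∀ {l Y₁ Y₂} → l ∈ Y₁ → l ∈ Y₂ → l ∈ Y₁ ∩ Y₂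
∩⁺ {Y₂ = Y₂} = ∈-filter⁺ (_∈? Y₂)

nondisjunctive-head : ∀ {Y} r → Nondisjunctive r → Any (_∈ Y) (head r) →
                      head₀ r ∈ Y
nondisjunctive-head (rule _ _ _ _) refl (here h∈Y) = h∈Y

_⊆_∪rulesFor_ : Program → Program → Literal → Set
P ⊆ P₁ ∪rulesFor l = ∀ {r} → r ∈ P → r ∈ P₁ ⊎ head₀ r ≡ l

-- If X is an answer set of P and P₁ only lacks rules for l, then a proper
-- submodel of P₁^X cannot contain l: it would be a model of P^X.
submodel-misses : ∀ {X P P₁ Y l} → AnswerSet X P → P ⊆ P₁ ∪rulesFor l →
                  Y ⊆ X → ¬ (X ⊆ Y) → Y ⊨ P₁ ^ X → l ∉ Y
submodel-misses {X} {P} {Y = Y} asX cover Y⊆X X⊈Y sat₁ l∈Y =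
  answerSet-minimal asX Y Y⊆X X⊈Y satisfies
  where
  satisfies : Y ⊨ P ^ X
  satisfies r∈P with cover r∈P
  ... | inj₁ r∈P₁ = sat₁ r∈P₁
  ... | inj₂ refl = λ _ _ → here l∈Y

Covers : Program → Program → Program → Literal → Set
Covers P P₁ P₂ l =
  ∀ {r} → r ∈ P → (r ∈ P₁ × r ∈ P₂) ⊎ (head₀ r ≡ l × (r ∈ P₁ ⊎ r ∈ P₂))

covers-left : ∀ {P P₁ P₂ l} → Covers P P₁ P₂ l → P ⊆ P₁ ∪rulesFor l
covers-left cover r∈P with cover r∈P
... | inj₁ (r∈P₁ , _) = inj₁ r∈P₁
... | inj₂ (r↦l , _)  = inj₂ r↦l

covers-right : ∀ {P P₁ P₂ l} → Covers P P₁ P₂ l → P ⊆ P₂ ∪rulesFor l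
covers-right cover r∈P with cover r∈P
... | inj₁ (_ , r∈P₂) = inj₁ r∈P₂
... | inj₂ (r↦l , _)  = inj₂ r↦l

-- Models of P₁^X and P₂^X that both miss l intersect to a model of P^X:
-- rules for l have a false body in one of them, and the remaining
-- (nondisjunctive) rules hold in both, hence in the intersection.
∩-model : ∀ {X P P₁ P₂ l Y₁ Y₂} → All Nondisjunctive P → Covers P P₁ P₂ l →
          Y₁ ⊨ P₁ ^ X → l ∉ Y₁ → Y₂ ⊨ P₂ ^ X → l ∉ Y₂ → (Y₁ ∩ Y₂) ⊨ P ^ X
∩-model {X} {P} {P₁} {P₂} {l} {Y₁} {Y₂} nd cover sat₁ l∉Y₁ sat₂ l∉Y₂
        {r} r∈P kept body⊆Y₁∩Y₂ = by-cases (cover r∈P)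
  where
  body⊆Y₁ : ∀ l′ → l′ ∈ body⁺ r → l′ ∈ Y₁
  body⊆Y₁ l′ l′∈ = proj₁ (∩⁻ Y₁ Y₂ (body⊆Y₁∩Y₂ l′ l′∈))

  body⊆Y₂ : ∀ l′ → l′ ∈ body⁺ r → l′ ∈ Y₂
  body⊆Y₂ l′ l′∈ = proj₂ (∩⁻ Y₁ Y₂ (body⊆Y₁∩Y₂ l′ l′∈))

  fires : ∀ {Y P′} → Y ⊨ P′ ^ X → r ∈ P′ → (∀ l′ → l′ ∈ body⁺ r → l′ ∈ Y) →
          head₀ r ∈ Y
  fires sat r∈P′ body = nondisjunctive-head r (All.lookup nd r∈P) (sat r∈P′ kept body)

  by-cases : (r ∈ P₁ × r ∈ P₂) ⊎ (head₀ r ≡ l × (r ∈ P₁ ⊎ r ∈ P₂)) →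
             Any (_∈ Y₁ ∩ Y₂) (head r)
  by-cases (inj₁ (r∈P₁ , r∈P₂)) =
    here (∩⁺ (fires sat₁ r∈P₁ body⊆Y₁) (fires sat₂ r∈P₂ body⊆Y₂))
  by-cases (inj₂ (r↦l , inj₁ r∈P₁)) =
    ⊥-elim (l∉Y₁ (subst (_∈ Y₁) r↦l (fires sat₁ r∈P₁ body⊆Y₁)))
  by-cases (inj₂ (r↦l , inj₂ r∈P₂)) =
    ⊥-elim (l∉Y₂ (subst (_∈ Y₂) r↦l (fires sat₂ r∈P₂ body⊆Y₂)))

-- Main abstract fact: an answer set X of a nondisjunctive program P remains
-- an answer set of P₁ or of P₂ whenever these subprograms cover P up to rules
-- for one literal.  (Stated constructively: both failing is absurd.)
cover-answerSet : ∀ {X P P₁ P₂ l} → AnswerSet X P → All Nondisjunctive P →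
                  Covers P P₁ P₂ l → P₁ ⊆ P → P₂ ⊆ P →
                  ¬ AnswerSet X P₁ → ¬ AnswerSet X P₂ → ⊥
cover-answerSet {X} {P₁ = P₁} {P₂} asX nd cover P₁⊆P P₂⊆P ¬as₁ ¬as₂ =
  ¬as₁ (answerSet-sub asX P₁⊆P minimal₁)
  where
  minimal₁ : Minimal X P₁
  minimal₁ Y₁ Y₁⊆X X⊈Y₁ sat₁ = ¬as₂ (answerSet-sub asX P₂⊆P minimal₂)
    where
    minimal₂ : Minimal X P₂
    minimal₂ Y₂ Y₂⊆X X⊈Y₂ sat₂ =
      answerSet-minimal asX (Y₁ ∩ Y₂)
        (λ l∈ → Y₁⊆X (proj₁ (∩⁻ Y₁ Y₂ l∈)))
        (λ X⊆Y → X⊈Y₁ (λ l∈X → proj₁ (∩⁻ Y₁ Y₂ (X⊆Y l∈X))))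
        (∩-model nd cover
          sat₁ (submodel-misses asX (covers-left cover) Y₁⊆X X⊈Y₁ sat₁)
          sat₂ (submodel-misses asX (covers-right cover) Y₂⊆X X⊈Y₂ sat₂))

_∪α_ : (P : CRProgram) → Subset (ncr P) → Program
P ∪α R = reg P ++ αSet R (cr P)

∈-selected⁺ : ∀ {n} (R : Subset n) (rs : Vec CRRule n) {k} →
              k ∈ₛ R → lookup rs k ∈ selected R rs
∈-selected⁺ (inside ∷ R)  (r ∷ rs) hereₛ = here refl
∈-selected⁺ (inside ∷ R)  (r ∷ rs) (thereₛ k∈R) =
  there (∈-selected⁺ R rs k∈R)
∈-selected⁺ (outside ∷ R) (r ∷ rs) (thereₛ k∈R) =
  ∈-selected⁺ R rs k∈R

∈-selected⁻ : ∀ {n} (R : Subset n) (rs : Vec CRRule n) {c} →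
              c ∈ selected R rs → ∃ λ k → k ∈ₛ R × c ≡ lookup rs k
∈-selected⁻ []            []       ()
∈-selected⁻ (inside ∷ R)  (r ∷ rs) (here c≡r) = zero , hereₛ , c≡r
∈-selected⁻ (inside ∷ R)  (r ∷ rs) (there c∈) =
  Product.map suc (Product.map₁ thereₛ) (∈-selected⁻ R rs c∈)
∈-selected⁻ (outside ∷ R) (r ∷ rs) c∈ =
  Product.map suc (Product.map₁ thereₛ) (∈-selected⁻ R rs c∈)

∈-∪α⁻ : ∀ P R {r} → r ∈ P ∪α R →
        r ∈ reg P ⊎ ∃ λ k → k ∈ₛ R × r ≡ α (lookup (cr P) k)
∈-∪α⁻ P R r∈ with ∈-++⁻ (reg P) r∈
... | inj₁ r∈reg = inj₁ r∈reg
... | inj₂ r∈α with ∈-map⁻ α r∈α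
...   | c , c∈R , refl =
  inj₂ (Product.map₂ (Product.map₂ (cong α)) (∈-selected⁻ R (cr P) c∈R))

∈-∪α⁺ : ∀ P R {k} → k ∈ₛ R → α (lookup (cr P) k) ∈ P ∪α R
∈-∪α⁺ P R k∈R = ∈-++⁺ʳ (reg P) (∈-map⁺ α (∈-selected⁺ R (cr P) k∈R))

∪α-mono : ∀ P R′ R → R′ ⊆ₛ R → P ∪α R′ ⊆ P ∪α R
∪α-mono P R′ R R′⊆R r∈ with ∈-∪α⁻ P R′ r∈
... | inj₁ r∈reg = ∈-++⁺ˡ r∈reg
... | inj₂ (k , k∈R′ , refl) = ∈-∪α⁺ P R (R′⊆R k∈R′)

∪α-nondisjunctive : ∀ P R → NondisjunctiveCR P → All Nondisjunctive (P ∪α R)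
∪α-nondisjunctive P R nd =
  All.++⁺ nd (All.map⁺ (All.tabulate λ {c} _ → refl {x = headRest (α c)}))

covers-drop-two : ∀ P {R i j} → i ∈ₛ R → j ∈ₛ R → i ≢ j →
                  crHead (lookup (cr P) i) ≡ crHead (lookup (cr P) j) →
                  Covers (P ∪α R) (P ∪α (R - i)) (P ∪α (R - j))
                         (crHead (lookup (cr P) i))
covers-drop-two P {R} {i} {j} i∈R j∈R i≢j same-head r∈ with ∈-∪α⁻ P R r∈
... | inj₁ r∈reg = inj₁ (∈-++⁺ˡ r∈reg , ∈-++⁺ˡ r∈reg)
... | inj₂ (k , k∈R , refl) with k Fin.≟ i | k Fin.≟ j
...   | yes refl | _ =
  inj₂ (refl , inj₂ (∈-∪α⁺ P (R - j) (x∈p∧x≢y⇒x∈p-y k∈R i≢j)))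
...   | no k≢i | yes refl =
  inj₂ (sym same-head , inj₁ (∈-∪α⁺ P (R - i) (x∈p∧x≢y⇒x∈p-y k∈R k≢i)))
...   | no k≢i | no k≢j =
  inj₁ ( ∈-∪α⁺ P (R - i) (x∈p∧x≢y⇒x∈p-y k∈R k≢i)
       , ∈-∪α⁺ P (R - j) (x∈p∧x≢y⇒x∈p-y k∈R k≢j))

support-drop : ∀ P {R k} → AbductiveSupport P R → k ∈ₛ R →
               ¬ ConsistentProgram (P ∪α (R - k))
support-drop P {R} {k} (_ , minimal) k∈R = minimal (R - k) (x∈p⇒∣p-x∣<∣p∣ k∈R)

lemma4 : (P : CRProgram) → NondisjunctiveCR P →
         (R : Subset (ncr P)) → AbductiveSupport P R →
         ∀ i j → i ∈ₛ R → j ∈ₛ R →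
         crHead (lookup (cr P) i) ≡ crHead (lookup (cr P) j) →
         lookup (cr P) i ≡ lookup (cr P) j
lemma4 P nd R support i j i∈R j∈R same-head with i Fin.≟ j
... | yes refl = refl
... | no i≢j = ⊥-elim
  (cover-answerSet asX (∪α-nondisjunctive P R nd)
    (covers-drop-two P i∈R j∈R i≢j same-head)
    (∪α-mono P (R - i) R (p─q⊆p R _)) (∪α-mono P (R - j) R (p─q⊆p R _))
    (λ asᵢ → support-drop P support i∈R (X , asᵢ))
    (λ asⱼ → support-drop P support j∈R (X , asⱼ)))
  where
  X = proj₁ (proj₁ support)
  asX = proj₂ (proj₁ support)
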